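{- Let $r\le c$ be positive integers. If there exists a $\mu$-way $1$-solely balanced set with block size $c$ and foundation size $v$, then there exists a resolvable $P_{r\times c}(K_{rv})$ with $\mu$ resolution classes.
   Context: A $\mu$-way $(v,k,1)$ trade consists of $\mu$ pairwise disjoint collections $T_1,\dots,T_\mu$ of equally many $k$-subsets (blocks) of a $v$-set such that every point lies in the same number of blocks in each $T_i$; it is Steiner if every point of the foundation (union of all blocks) lies in at most one block of each $T_i$. A $\mu$-way $1$-solely balanced set is such a Steiner trade in which no block of $T_j$ and block of $T_b$, $j\ne b$, share more than one element; the block size is $k$ and the foundation size is the number of points covered. For a $w$-set $V$, an $r\times c$ grid-block packing $P_{r\times c}(K_w)$ is a pair $(V,\mathcal A)$ where $\mathcal A$ is a collection of $r\times c$ arrays with entries in $V$ such that any two distinct points of $V$ occur together at most once in the same row or the same column of arrays in $\mathcal A$. It is resolvable if $\mathcal A$ can be partitioned into resolution classes such that every point of $V$ lies in precisely one array of each class. -}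

module Defs where

open import Data.Nat using (ℕ; _≤_; _*_)
open import Data.Fin using (Fin)
open import Data.Fin.Subset using (Subset; _∩_; ∣_∣; ⋃)
open import Data.Fin.Subset.Properties using (_∈?_)
open import Data.List using (List; length; filter; allFin; concatMap; map)
open import Data.Product using (_×_; ∃-syntax)
open import Data.Sum using (_⊎_; inj₁; inj₂)
open import Relation.Binary.PropositionalEquality using (_≡_; _≢_)

occ : ∀ {n b} → (Fin b → Subset n) → Fin n → ℕ
occ {b = b} B x = length (filter (λ j → x ∈? B j) (allFin b))

foundation : ∀ {μ n b} → (Fin μ → Fin b → Subset n) → Subset n
foundation {μ} {n} {b} T = ⋃ (concatMap (λ i → map (T i) (allFin b)) (allFin μ))

-- A μ-way 1-solely balanced set with block size k and foundation size v,
-- on an underlying point set Fin n; each collection T i has b blocks,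
-- indexed by Fin b (distinct blocks, so it is a set of k-subsets).
record SolelyBalancedSet (μ k v : ℕ) : Set where
  field
    n : ℕ
    b : ℕ
    T : Fin μ → Fin b → Subset n
    blockSize      : ∀ i j → ∣ T i j ∣ ≡ k
    distinctBlocks : ∀ i j j′ → T i j ≡ T i j′ → j ≡ j′
    disjoint       : ∀ i i′ j j′ → T i j ≡ T i′ j′ → i ≡ i′
    balanced       : ∀ i i′ x → occ (T i) x ≡ occ (T i′) x
    steiner        : ∀ i x → occ (T i) x ≤ 1
    solely         : ∀ i i′ j j′ → i ≢ i′ → ∣ T i j ∩ T i′ j′ ∣ ≤ 1
    foundationSize : ∣ foundation T ∣ ≡ v

Array : ℕ → ℕ → ℕ → Set
Array r c w = Fin r → Fin c → Fin w

appears : ∀ {r c w} → Fin w → Array r c w → Set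
appears x A = ∃[ i ] ∃[ j ] A i j ≡ x

inLine : ∀ {r c w} → Array r c w → Fin r ⊎ Fin c → Fin w → Set
inLine A (inj₁ i) x = ∃[ j ] A i j ≡ x
inLine A (inj₂ j) x = ∃[ i ] A i j ≡ x

record ResolvableGBP (r c w μ : ℕ) : Set where
  field
    m : ℕ
    A : Fin m → Array r c w
    entriesDistinct : ∀ a i j i′ j′ → A a i j ≡ A a i′ j′ → (i ≡ i′ × j ≡ j′)
    arraysDistinct  : ∀ a a′ → (∀ i j → A a i j ≡ A a′ i j) → a ≡ a′
    packing : ∀ x y → x ≢ y → ∀ a a′ l l′ →
              inLine (A a) l x → inLine (A a) l y →
              inLine (A a′) l′ x → inLine (A a′) l′ y →
              (a ≡ a′ × l ≡ l′)
    cls : Fin m → Fin μ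
    resolution : ∀ (k : Fin μ) (x : Fin w) →
                 ∃[ a ] ((cls a ≡ k × appears x (A a)) ×
                         (∀ a′ → cls a′ ≡ k → appears x (A a′) → a′ ≡ a))

module Submission where

-- The points are r copies of the foundation F: pairs (s , y), s : Fin r,
-- y ∈ F.  Fix an r × c Latin rectangle L (the cyclic L s t = s + t mod c,
-- which needs r ≤ c).  A block B = T i j, enumerated as B(0), …, B(c-1),
-- gives the array A i j with entry (s , B(L s t)) in cell (s , t).  Class i
-- consists of the arrays A i j, which cover every point once as T i
-- partitions F.  Distinct points on a common line lie over distinct points
-- of F in the line's block, and in a solely balanced set two points lie in
-- at most one block, which yields the packing property.

open import Defs
open import Data.Nat using (ℕ; _≤_; _*_; suc; _+_; _∸_; z≤n; s≤s; NonZero; >-nonZero)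
open import Data.Nat.Properties
  using (+-comm; +-assoc; <⇒≤; ≤-trans; <⇒≱; m+[n∸m]≡n; m∸n+n≡m)
open import Data.Nat.DivMod
  using (_%_; m%n<n; m%n%n≡m%n; %-distribˡ-+; [m+n]%n≡m%n; m<n⇒m%n≡m)
open import Data.Fin using (Fin; toℕ; fromℕ<; inject≤; combine; remQuot)
open import Data.Fin.Properties
  using (toℕ<n; toℕ-injective; toℕ-fromℕ<; inject≤-injective;
         combine-remQuot; remQuot-combine; suc-injective; _≟_)
open import Data.Fin.Subset using (Subset; _∈_; ∣_∣; ⋃; _⊆_; inside; outside)
open import Data.Fin.Subset.Properties
  using (_∈?_; x∈p∪q⁺; x∈p∪q⁻; ∉⊥; x∈p∩q⁺; ⊆-antisym; p⊆q⇒∣p∣≤∣q∣;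
         ∣⁅x⁆∣≡1; x∈⁅y⁆⇒x≡y; x∈p∧x≢y⇒x∈p-y; x∈p⇒∣p-x∣<∣p∣)
open import Data.Vec.Base using ([]; _∷_; here; there)
open import Data.List using (List; []; _∷_; length; filter; allFin; map)
open import Data.List.Relation.Unary.Any using (Any; here; there)
open import Data.List.Relation.Unary.Any.Properties
  using (map⁺; map⁻; concatMap⁺; concatMap⁻; tabulate⁺; tabulate⁻)
open import Data.List.Membership.Propositional using () renaming (_∈_ to _∈ₗ_)
open import Data.List.Membership.Propositional.Properties using (∈-allFin; ∈-filter⁺; ∈-filter⁻)
open import Data.Product using (_×_; _,_; ∃-syntax; proj₁; proj₂; uncurry)
open import Data.Product.Properties using (×-≡,≡→≡)
open import Data.Sum using (inj₁; inj₂; [_,_])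
open import Function using (_∘_)
open import Relation.Nullary using (yes; no)
open import Relation.Nullary.Negation using (contradiction)
open import Relation.Binary.PropositionalEquality
  using (_≡_; _≢_; refl; sym; trans; cong; subst; module ≡-Reasoning)

open ≡-Reasoning

∈⇒1≤∣p∣ : ∀ {n} {p : Subset n} {x} → x ∈ p → 1 ≤ ∣ p ∣
∈⇒1≤∣p∣ {p = p} {x} x∈p =
  subst (_≤ ∣ p ∣) (∣⁅x⁆∣≡1 x)
    (p⊆q⇒∣p∣≤∣q∣ (λ y∈⁅x⁆ → subst (_∈ p) (sym (x∈⁅y⁆⇒x≡y x y∈⁅x⁆)) x∈p))

∈∈⇒2≤∣p∣ : ∀ {n} {p : Subset n} {x y} → x ≢ y → x ∈ p → y ∈ p → 2 ≤ ∣ p ∣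
∈∈⇒2≤∣p∣ x≢y x∈p y∈p =
  ≤-trans (s≤s (∈⇒1≤∣p∣ (x∈p∧x≢y⇒x∈p-y y∈p (x≢y ∘ sym)))) (x∈p⇒∣p-x∣<∣p∣ x∈p)

module _ {A : Set} where

  ∈⇒1≤length : ∀ {x : A} {xs} → x ∈ₗ xs → 1 ≤ length xs
  ∈⇒1≤length (here _)  = s≤s z≤n
  ∈⇒1≤length (there _) = s≤s z≤n

  1≤length⇒∈ : ∀ {xs : List A} → 1 ≤ length xs → ∃[ x ] x ∈ₗ xs
  1≤length⇒∈ {x ∷ _} _ = x , here refl

  length≤1⇒∈-unique : ∀ {x y : A} {xs} → length xs ≤ 1 → x ∈ₗ xs → y ∈ₗ xs → x ≡ y
  length≤1⇒∈-unique {xs = _ ∷ []}    _        (here refl) (here refl) = refl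
  length≤1⇒∈-unique {xs = _ ∷ _ ∷ _} (s≤s ()) _           _

module _ {n b : ℕ} (B : Fin b → Subset n) {x : Fin n} where

  occ-pos : ∀ {j} → x ∈ B j → 1 ≤ occ B x
  occ-pos {j} x∈B = ∈⇒1≤length (∈-filter⁺ (λ k → x ∈? B k) (∈-allFin j) x∈B)

  occ-witness : 1 ≤ occ B x → ∃[ j ] x ∈ B j
  occ-witness 1≤occ =
    let j , j∈ = 1≤length⇒∈ 1≤occ
    in  j , proj₂ (∈-filter⁻ (λ k → x ∈? B k) {xs = allFin b} j∈)

  occ≤1⇒unique : occ B x ≤ 1 → ∀ {j j′} → x ∈ B j → x ∈ B j′ → j ≡ j′
  occ≤1⇒unique occ≤1 {j} {j′} x∈Bj x∈Bj′ =
    length≤1⇒∈-unique occ≤1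
      (∈-filter⁺ (λ k → x ∈? B k) (∈-allFin j) x∈Bj)
      (∈-filter⁺ (λ k → x ∈? B k) (∈-allFin j′) x∈Bj′)

∈⋃⁺ : ∀ {n} {x : Fin n} (L : List (Subset n)) → Any (x ∈_) L → x ∈ ⋃ L
∈⋃⁺ (_ ∷ _) (here x∈S)  = x∈p∪q⁺ (inj₁ x∈S)
∈⋃⁺ (_ ∷ L) (there x∈L) = x∈p∪q⁺ (inj₂ (∈⋃⁺ L x∈L))

∈⋃⁻ : ∀ {n} {x : Fin n} (L : List (Subset n)) → x ∈ ⋃ L → Any (x ∈_) L
∈⋃⁻ []      x∈⋃ = contradiction x∈⋃ ∉⊥
∈⋃⁻ (S ∷ L) x∈⋃ = [ here , there ∘ ∈⋃⁻ L ] (x∈p∪q⁻ S (⋃ L) x∈⋃)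

module _ {μ n b : ℕ} (T : Fin μ → Fin b → Subset n) {x : Fin n} where

  blocksOf : Fin μ → List (Subset n)
  blocksOf i = map (T i) (allFin b)

  ∈foundation⁺ : ∀ {i j} → x ∈ T i j → x ∈ foundation T
  ∈foundation⁺ {i} {j} x∈T = ∈⋃⁺ _ (concatMap⁺ blocksOf (tabulate⁺ i (map⁺ (tabulate⁺ j x∈T))))

  ∈foundation⁻ : x ∈ foundation T → ∃[ i ] ∃[ j ] x ∈ T i j
  ∈foundation⁻ x∈F =
    let i , x∈Ti = tabulate⁻ (concatMap⁻ blocksOf (∈⋃⁻ _ x∈F))
    in  i , tabulate⁻ (map⁻ x∈Ti)

record Enumeration {n : ℕ} (S : Subset n) (k : ℕ) : Set where
  field
    elem           : Fin k → Fin n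
    elem∈          : ∀ t → elem t ∈ S
    elem-injective : ∀ {t t′} → elem t ≡ elem t′ → t ≡ t′
    elem-onto      : ∀ {x} → x ∈ S → ∃[ t ] elem t ≡ x

module _ {n k : ℕ} {S : Subset n} (E : Enumeration S k) where
  open Enumeration E

  skipHead : Enumeration (outside ∷ S) k
  skipHead = record
    { elem           = Fin.suc ∘ elem
    ; elem∈          = there ∘ elem∈
    ; elem-injective = elem-injective ∘ suc-injective
    ; elem-onto      = λ { (there x∈S) → let t , e = elem-onto x∈S in t , cong Fin.suc e }
    }

  keepHead : Enumeration (inside ∷ S) (suc k)
  keepHead = record
    { elem           = elem′
    ; elem∈          = elem′∈
    ; elem-injective = elem′-injective
    ; elem-onto      = elem′-onto
    }
    where
    elem′ : Fin (suc k) → Fin (suc n)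
    elem′ Fin.zero    = Fin.zero
    elem′ (Fin.suc t) = Fin.suc (elem t)

    elem′∈ : ∀ t → elem′ t ∈ (inside ∷ S)
    elem′∈ Fin.zero    = here
    elem′∈ (Fin.suc t) = there (elem∈ t)

    elem′-injective : ∀ {t t′} → elem′ t ≡ elem′ t′ → t ≡ t′
    elem′-injective {Fin.zero}  {Fin.zero}   _ = refl
    elem′-injective {Fin.suc _} {Fin.suc _}  e =
      cong Fin.suc (elem-injective (suc-injective e))

    elem′-onto : ∀ {x} → x ∈ (inside ∷ S) → ∃[ t ] elem′ t ≡ x
    elem′-onto here        = Fin.zero , refl
    elem′-onto (there x∈S) = let t , e = elem-onto x∈S in Fin.suc t , cong Fin.suc e

enumerate : ∀ {n} (S : Subset n) → Enumeration S ∣ S ∣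
enumerate []            = record { elem = λ () ; elem∈ = λ () ; elem-injective = λ { {()} } ; elem-onto = λ () }
enumerate (outside ∷ S) = skipHead (enumerate S)
enumerate (inside ∷ S)  = keepHead (enumerate S)

record LatinRectangle (r c : ℕ) : Set where
  field
    symbol           : Fin r → Fin c → Fin c
    row-injective    : ∀ s {t t′} → symbol s t ≡ symbol s t′ → t ≡ t′
    row-onto         : ∀ s u → ∃[ t ] symbol s t ≡ u
    column-injective : ∀ t {s s′} → symbol s t ≡ symbol s′ t → s ≡ s′

[m+n%d]%d≡[m+n]%d : ∀ m n d .{{_ : NonZero d}} → (m + n % d) % d ≡ (m + n) % d
[m+n%d]%d≡[m+n]%d m n d = begin
  (m + n % d) % d           ≡⟨ %-distribˡ-+ m (n % d) d ⟩
  (m % d + n % d % d) % d   ≡⟨ cong (λ z → (m % d + z) % d) (m%n%n≡m%n n d) ⟩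
  (m % d + n % d) % d       ≡⟨ %-distribˡ-+ m n d ⟨
  (m + n) % d               ∎

module Cyclic (c : ℕ) .{{_ : NonZero c}} where

  shift : ℕ → Fin c → Fin c
  shift a t = fromℕ< (m%n<n (a + toℕ t) c)

  toℕ-shift : ∀ a t → toℕ (shift a t) ≡ (a + toℕ t) % c
  toℕ-shift a t = toℕ-fromℕ< _

  shift-inverse : ∀ {a b} → a + b ≡ c → ∀ t → shift b (shift a t) ≡ t
  shift-inverse {a} {b} a+b≡c t = toℕ-injective (begin
    toℕ (shift b (shift a t))   ≡⟨ toℕ-shift b (shift a t) ⟩
    (b + toℕ (shift a t)) % c   ≡⟨ cong (λ z → (b + z) % c) (toℕ-shift a t) ⟩
    (b + (a + toℕ t) % c) % c   ≡⟨ [m+n%d]%d≡[m+n]%d b (a + toℕ t) c ⟩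
    (b + (a + toℕ t)) % c       ≡⟨ cong (_% c) (+-assoc b a (toℕ t)) ⟨
    (b + a + toℕ t) % c         ≡⟨ cong (λ z → (z + toℕ t) % c) (trans (+-comm b a) a+b≡c) ⟩
    (c + toℕ t) % c             ≡⟨ cong (_% c) (+-comm c (toℕ t)) ⟩
    (toℕ t + c) % c             ≡⟨ [m+n]%n≡m%n (toℕ t) c ⟩
    toℕ t % c                   ≡⟨ m<n⇒m%n≡m (toℕ<n t) ⟩
    toℕ t                       ∎)

  shift-comm : ∀ (s t : Fin c) → shift (toℕ s) t ≡ shift (toℕ t) s
  shift-comm s t = toℕ-injective (begin
    toℕ (shift (toℕ s) t)   ≡⟨ toℕ-shift (toℕ s) t ⟩
    (toℕ s + toℕ t) % c     ≡⟨ cong (_% c) (+-comm (toℕ s) (toℕ t)) ⟩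
    (toℕ t + toℕ s) % c     ≡⟨ toℕ-shift (toℕ t) s ⟨
    toℕ (shift (toℕ t) s)   ∎)

  shift-injective : ∀ {a} → a ≤ c → ∀ {t t′} → shift a t ≡ shift a t′ → t ≡ t′
  shift-injective {a} a≤c {t} {t′} e = begin
    t                         ≡⟨ shift-inverse (m+[n∸m]≡n a≤c) t ⟨
    shift (c ∸ a) (shift a t)  ≡⟨ cong (shift (c ∸ a)) e ⟩
    shift (c ∸ a) (shift a t′) ≡⟨ shift-inverse (m+[n∸m]≡n a≤c) t′ ⟩
    t′                        ∎

  cyclicLatinSquare : LatinRectangle c c
  cyclicLatinSquare = record
    { symbol           = λ s → shift (toℕ s)
    ; row-injective    = λ s → shift-injective (s≤c s)
    ; row-onto         = λ s u → shift (c ∸ toℕ s) u , shift-inverse (m∸n+n≡m (s≤c s)) u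
    ; column-injective = λ t {s} {s′} e →
        shift-injective (s≤c t) (trans (shift-comm t s) (trans e (shift-comm s′ t)))
    }
    where
    s≤c : ∀ (s : Fin c) → toℕ s ≤ c
    s≤c s = <⇒≤ (toℕ<n s)

restrictRows : ∀ {r r′ c} → r ≤ r′ → LatinRectangle r′ c → LatinRectangle r c
restrictRows r≤r′ L = record
  { symbol           = symbol ∘ embed
  ; row-injective    = row-injective ∘ embed
  ; row-onto         = row-onto ∘ embed
  ; column-injective = λ t e → inject≤-injective r≤r′ r≤r′ _ _ (column-injective t e)
  }
  where
  open LatinRectangle L
  embed : Fin _ → Fin _
  embed s = inject≤ s r≤r′

EntriesDistinct : ∀ {r c w} → Array r c w → Set
EntriesDistinct A = ∀ s t s′ t′ → A s t ≡ A s′ t′ → s ≡ s′ × t ≡ t′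

module _ {r c w : ℕ} {A : Array r c w} (distinct : EntriesDistinct A) where

  row∩column : ∀ {s t x} → inLine A (inj₁ s) x → inLine A (inj₂ t) x → x ≡ A s t
  row∩column {s} {t} (t₁ , refl) (s₁ , e) = cong (A s) (sym (proj₂ (distinct s₁ t s t₁ e)))

  lines-meet-once : ∀ {x y} l l′ → x ≢ y →
    inLine A l x → inLine A l y → inLine A l′ x → inLine A l′ y → l ≡ l′
  lines-meet-once (inj₁ s) (inj₁ s′) _ (t , e) _ (t′ , e′) _ =
    cong inj₁ (proj₁ (distinct s t s′ t′ (trans e (sym e′))))
  lines-meet-once (inj₂ t) (inj₂ t′) _ (s , e) _ (s′ , e′) _ =
    cong inj₂ (proj₂ (distinct s t s′ t′ (trans e (sym e′))))
  lines-meet-once (inj₁ s) (inj₂ t) x≢y xr yr xc yc =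
    contradiction (trans (row∩column xr xc) (sym (row∩column yr yc))) x≢y
  lines-meet-once (inj₂ t) (inj₁ s) x≢y xc yc xr yr =
    contradiction (trans (row∩column xr xc) (sym (row∩column yr yc))) x≢y

remQuot-injective : ∀ {m} n {a a′ : Fin (m * n)} → remQuot {m} n a ≡ remQuot {m} n a′ → a ≡ a′
remQuot-injective {m} n {a} {a′} e = begin
  a                                  ≡⟨ combine-remQuot {m} n a ⟨
  uncurry combine (remQuot {m} n a)  ≡⟨ cong (uncurry combine) e ⟩
  uncurry combine (remQuot {m} n a′) ≡⟨ combine-remQuot {m} n a′ ⟩
  a′                                 ∎

module SolelyBalancedProperties {μ k v : ℕ} (SB : SolelyBalancedSet μ k v) where
  open SolelyBalancedSet SB

  covered : ∀ {x} → x ∈ foundation T → ∀ i → ∃[ j ] x ∈ T i j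
  covered x∈F i =
    let i′ , j′ , x∈T = ∈foundation⁻ T x∈F
    in  occ-witness (T i) (subst (1 ≤_) (balanced i′ i _) (occ-pos (T i′) x∈T))

  steinerUnique : ∀ {x i j j′} → x ∈ T i j → x ∈ T i j′ → j ≡ j′
  steinerUnique {x} {i} = occ≤1⇒unique (T i) (steiner i x)

  pairDeterminesBlock : ∀ {x y i j i′ j′} → x ≢ y →
    x ∈ T i j → y ∈ T i j → x ∈ T i′ j′ → y ∈ T i′ j′ → i ≡ i′ × j ≡ j′
  pairDeterminesBlock {i = i} {i′ = i′} x≢y x∈ y∈ x∈′ y∈′ with i ≟ i′
  ... | yes refl = refl , steinerUnique x∈ x∈′
  ... | no i≢i′  = contradiction (solely i i′ _ _ i≢i′)
                     (<⇒≱ (∈∈⇒2≤∣p∣ x≢y (x∈p∩q⁺ (x∈ , x∈′)) (x∈p∩q⁺ (y∈ , y∈′))))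

-- The grid-block packing built from a solely balanced set SB with block size
-- c and a Latin rectangle L; the row s₀ witnesses that arrays are non-empty.
module Construction {r c μ v : ℕ} (SB : SolelyBalancedSet μ c v)
                    (L : LatinRectangle r c) (s₀ : Fin r) where
  open SolelyBalancedSet SB
  open SolelyBalancedProperties SB
  open LatinRectangle L

  F : Subset n
  F = foundation T

  enumF : Enumeration F v
  enumF = subst (Enumeration F) foundationSize (enumerate F)

  enumB : ∀ i j → Enumeration (T i j) c
  enumB i j = subst (Enumeration (T i j)) (blockSize i j) (enumerate (T i j))

  module EF = Enumeration enumF
  module EB i j = Enumeration (enumB i j)

  -- Points of K_{rv}: the point x is copy (layer x) of the point (base x) of F.
  layer : Fin (r * v) → Fin r
  layer x = proj₁ (remQuot {r} v x)

  base : Fin (r * v) → Fin n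
  base x = EF.elem (proj₂ (remQuot {r} v x))

  point : Fin r → ∀ {y} → y ∈ F → Fin (r * v)
  point s y∈F = combine s (proj₁ (EF.elem-onto y∈F))

  layer-point : ∀ s {y} (y∈F : y ∈ F) → layer (point s y∈F) ≡ s
  layer-point s y∈F = cong proj₁ (remQuot-combine {k = v} s _)

  base-point : ∀ s {y} (y∈F : y ∈ F) → base (point s y∈F) ≡ y
  base-point s y∈F =
    trans (cong (EF.elem ∘ proj₂) (remQuot-combine {k = v} s _)) (proj₂ (EF.elem-onto y∈F))

  point-unique : ∀ {x x′} → layer x ≡ layer x′ → base x ≡ base x′ → x ≡ x′
  point-unique e₁ e₂ = remQuot-injective _ (×-≡,≡→≡ (e₁ , EF.elem-injective e₂))

  cell : Fin μ → Fin b → Fin r → Fin c → Fin n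
  cell i j s t = EB.elem i j (symbol s t)

  cell-onto : ∀ {i j y} → y ∈ T i j → ∀ s → ∃[ t ] cell i j s t ≡ y
  cell-onto {i} {j} y∈T s =
    let u , eu = EB.elem-onto i j y∈T
        t , et = row-onto s u
    in  t , trans (cong (EB.elem i j) et) eu

  array : Fin μ → Fin b → Array r c (r * v)
  array i j s t = point s (∈foundation⁺ T (EB.elem∈ i j (symbol s t)))

  layer-array : ∀ i j s t → layer (array i j s t) ≡ s
  layer-array i j s t = layer-point s _

  base-array : ∀ i j s t → base (array i j s t) ≡ cell i j s t
  base-array i j s t = base-point s _

  base≡⇒cell≡ : ∀ {i j s t i′ j′ s′ t′} → base (array i j s t) ≡ base (array i′ j′ s′ t′) →
                cell i j s t ≡ cell i′ j′ s′ t′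
  base≡⇒cell≡ {i} {j} {s} {t} {i′} {j′} {s′} {t′} e =
    trans (sym (base-array i j s t)) (trans e (base-array i′ j′ s′ t′))

  entry∈block : ∀ {i j s t x} → array i j s t ≡ x → base x ∈ T i j
  entry∈block {i} {j} {s} {t} refl =
    subst (_∈ T i j) (sym (base-array i j s t)) (EB.elem∈ i j (symbol s t))

  array-distinct : ∀ i j → EntriesDistinct (array i j)
  array-distinct i j s t s′ t′ e with trans (sym (layer-array i j s t))
                                        (trans (cong layer e) (layer-array i j s′ t′))
  ... | refl = refl , row-injective s (EB.elem-injective i j (base≡⇒cell≡ (cong base e)))

  line∈block : ∀ {i j x} l → inLine (array i j) l x → base x ∈ T i j
  line∈block (inj₁ _) (_ , e) = entry∈block e
  line∈block (inj₂ _) (_ , e) = entry∈block e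

  line-base-injective : ∀ {i j x y} l → inLine (array i j) l x → inLine (array i j) l y →
                        base x ≡ base y → x ≡ y
  line-base-injective {i} {j} (inj₁ s) (t , refl) (t′ , refl) e =
    cong (array i j s) (row-injective s (EB.elem-injective i j (base≡⇒cell≡ e)))
  line-base-injective {i} {j} (inj₂ t) (s , refl) (s′ , refl) e =
    cong (λ z → array i j z t) (column-injective t (EB.elem-injective i j (base≡⇒cell≡ e)))

  -- Row s₀ of an array lists its whole block, so equal arrays have equal blocks.
  array-injective : ∀ {i j i′ j′} → (∀ s t → array i j s t ≡ array i′ j′ s t) →
                    i ≡ i′ × j ≡ j′
  array-injective {i} {j} {i′} {j′} same = i≡i′ , blocks≡⇒j≡j′ i≡i′ T≡T′
    where
    sameCell : ∀ t → cell i j s₀ t ≡ cell i′ j′ s₀ t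
    sameCell t = base≡⇒cell≡ (cong base (same s₀ t))

    row₀⊆ : ∀ {i j i′ j′} → (∀ t → cell i j s₀ t ≡ cell i′ j′ s₀ t) → T i j ⊆ T i′ j′
    row₀⊆ {i} {j} {i′} {j′} e y∈T =
      let t , et = cell-onto y∈T s₀
      in  subst (_∈ T i′ j′) (trans (sym (e t)) et) (EB.elem∈ i′ j′ (symbol s₀ t))

    T≡T′ : T i j ≡ T i′ j′
    T≡T′ = ⊆-antisym (row₀⊆ sameCell) (row₀⊆ (sym ∘ sameCell))

    i≡i′ : i ≡ i′
    i≡i′ = disjoint i i′ j j′ T≡T′

    blocks≡⇒j≡j′ : i ≡ i′ → T i j ≡ T i′ j′ → j ≡ j′
    blocks≡⇒j≡j′ refl = distinctBlocks i j j′

  arr : Fin (μ * b) → Array r c (r * v)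
  arr a = uncurry array (remQuot {μ} b a)

  class : Fin (μ * b) → Fin μ
  class a = proj₁ (remQuot {μ} b a)

  arr-combine : ∀ i j → arr (combine i j) ≡ array i j
  arr-combine i j = cong (uncurry array) (remQuot-combine i j)

  packing : ∀ x y → x ≢ y → ∀ a a′ l l′ →
            inLine (arr a) l x → inLine (arr a) l y →
            inLine (arr a′) l′ x → inLine (arr a′) l′ y → a ≡ a′ × l ≡ l′
  packing x y x≢y a a′ l l′ xl yl xl′ yl′ with remQuot-injective b (×-≡,≡→≡ sameBlock)
    where
    sameBlock : class a ≡ class a′ × proj₂ (remQuot {μ} b a) ≡ proj₂ (remQuot {μ} b a′)
    sameBlock = pairDeterminesBlock (x≢y ∘ line-base-injective l xl yl)
                  (line∈block l xl) (line∈block l yl) (line∈block l′ xl′) (line∈block l′ yl′)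
  ... | refl = refl , lines-meet-once (array-distinct _ _) l l′ x≢y xl yl xl′ yl′

  -- Each class meets each point x exactly once: in the array of the unique
  -- block of that class containing the base of x.
  resolution : ∀ k x → ∃[ a ] ((class a ≡ k × appears x (arr a)) ×
                               (∀ a′ → class a′ ≡ k → appears x (arr a′) → a′ ≡ a))
  resolution k x =
    combine k j , (cong proj₁ (remQuot-combine k j) , x∈array) , unique
    where
    x∈block : ∃[ j ] base x ∈ T k j
    x∈block = covered (EF.elem∈ _) k

    j : Fin b
    j = proj₁ x∈block

    x∈array : appears x (arr (combine k j))
    x∈array =
      let t , et = cell-onto (proj₂ x∈block) (layer x)
      in  subst (appears x) (sym (arr-combine k j))
            (layer x , t , point-unique (layer-array k j (layer x) t)
                                       (trans (base-array k j (layer x) t) et))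

    unique : ∀ a′ → class a′ ≡ k → appears x (arr a′) → a′ ≡ combine k j
    unique a′ refl (_ , _ , e) = remQuot-injective b (begin
      remQuot {μ} b a′            ≡⟨ ×-≡,≡→≡ (refl , steinerUnique (entry∈block e) (proj₂ x∈block)) ⟩
      (k , j)                     ≡⟨ remQuot-combine k j ⟨
      remQuot {μ} b (combine k j) ∎)

  gbp : ResolvableGBP r c (r * v) μ
  gbp = record
    { m               = μ * b
    ; A               = arr
    ; entriesDistinct = λ a → array-distinct _ _
    ; arraysDistinct  = λ a a′ same →
        remQuot-injective b (×-≡,≡→≡ (array-injective same))
    ; packing         = packing
    ; cls             = class
    ; resolution      = resolution
    }

mainTheorem5 : (r c μ v : ℕ) → 1 ≤ r → r ≤ c →
    SolelyBalancedSet μ c v → ResolvableGBP r c (r * v) μ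
mainTheorem5 r c μ v 1≤r r≤c SB = Construction.gbp SB latinRectangle (fromℕ< 1≤r)
  where
  instance
    c≢0 : NonZero c
    c≢0 = >-nonZero (≤-trans 1≤r r≤c)

  latinRectangle : LatinRectangle r c
  latinRectangle = restrictRows r≤c (Cyclic.cyclicLatinSquare c)
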